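{- Let $s\ge g\ge 3$ and let $V$ be the set of $s^2$ treatments of a pseudo-$L_g(s)$ association scheme. Suppose there are $g$ partitions $\mathcal P_1,\dots,\mathcal P_g$ of $V$, where $\mathcal P_i=\{B^i_1,\dots,B^i_s\}$ consists of $s$ pairwise disjoint cliques. Then the following are equivalent: (A) for any $i\neq j$ in $\{1,\dots,g\}$ and any $m,n\in\{1,\dots,s\}$, $B^i_m$ and $B^j_n$ have exactly one common treatment; (B) for every treatment $t\in V$ there exist pairwise disjoint sets $A_1,\dots,A_g$, each of cardinality $s-1$, whose union is the set of all first associates of $t$, such that each $\{t\}\cup A_k$ is a clique, and such that for each $i=1,\dots,g$ the block $B^i_{m_i}$ of $\mathcal P_i$ containing $t$ equals $\{t\}\cup A_{k_i}$ for some $k_i\in\{1,\dots,g\}$, where $i\mapsto k_i$ is a bijection of $\{1,\dots,g\}$.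
   Context: An association scheme with two associate classes on $v$ treatments is a symmetric relation splitting every pair of distinct treatments into first or second associates such that each treatment has $n_i$ $i$-th associates and for two $i$-th associates the number of treatments that are $j$-th associates of the first and $k$-th associates of the second is a constant $p^i_{jk}$. A pseudo-$L_g(s)$ association scheme has $v=s^2$, $n_1=g(s-1)$, $p^1_{11}=(s-2)+(g-1)(g-2)$, $p^2_{11}=g(g-1)$. A clique is a set of treatments any two distinct of which are first associates. -}

module Defs where

open import Data.Nat using (ℕ; zero; suc; _+_; _*_; _∸_)
open import Data.Bool using (Bool; true; false; _∧_; _∨_; not; if_then_else_)
open import Data.Fin using (Fin; zero; suc; _≟_)
open import Data.Product using (Σ; _×_; ∃; ∃-syntax)
open import Relation.Nullary using (¬_)
open import Relation.Nullary.Decidable using (⌊_⌋)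
open import Relation.Binary.PropositionalEquality using (_≡_; _≢_)
open import Function.Bundles using (_⇔_)
open import Function.Definitions using (Bijective)

card : ∀ {n} → (Fin n → Bool) → ℕ
card {zero}  f = 0
card {suc n} f = (if f zero then 1 else 0) + card (λ x → f (suc x))

_==_ : ∀ {n} → Fin n → Fin n → Bool
x == y = ⌊ x ≟ y ⌋

data Cls : Set where
  c1 c2 : Cls

assocᵇ : ∀ {v} → (Fin v → Fin v → Bool) → Cls → Fin v → Fin v → Bool
assocᵇ first c1 x y = not (x == y) ∧ first x y
assocᵇ first c2 x y = not (x == y) ∧ not (first x y)

record AssocScheme (v : ℕ) : Set where
  field
    first      : Fin v → Fin v → Bool
    first-irr  : ∀ x → first x x ≡ false
    first-sym  : ∀ x y → first x y ≡ first y x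
    n          : Cls → ℕ
    valency    : ∀ c x → card (assocᵇ first c x) ≡ n c
    p          : Cls → Cls → Cls → ℕ   -- p i j k  stands for  p^i_{jk}
    intersect  : ∀ i j k x y → assocᵇ first i x y ≡ true →
                 card (λ z → assocᵇ first j x z ∧ assocᵇ first k y z) ≡ p i j k

open AssocScheme public

IsPseudoL : (g s : ℕ) → AssocScheme (s * s) → Set
IsPseudoL g s S =
  (n S c1 ≡ g * (s ∸ 1)) ×
  (p S c1 c1 c1 ≡ (s ∸ 2) + (g ∸ 1) * (g ∸ 2)) ×
  (p S c2 c1 c1 ≡ g * (g ∸ 1))

IsClique : ∀ {v} → AssocScheme v → (Fin v → Bool) → Set
IsClique S X = ∀ x y → X x ≡ true → X y ≡ true → x ≢ y → first S x y ≡ true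

IsCliquePartition : ∀ {v s} → AssocScheme v → (Fin s → Fin v → Bool) → Set
IsCliquePartition {v} {s} S B =
  (∀ m → IsClique S (B m)) ×
  (∀ m → ∃[ t ] B m t ≡ true) ×
  (∀ t → ∃[ m ] B m t ≡ true) ×
  (∀ m m' t → B m t ≡ true → B m' t ≡ true → m ≡ m')

CondA : ∀ {v g s} → (Fin g → Fin s → Fin v → Bool) → Set
CondA {v} {g} {s} B =
  ∀ (i j : Fin g) → i ≢ j → ∀ (m n : Fin s) → card (λ t → B i m t ∧ B j n t) ≡ 1

CondB : ∀ {g s} → (S : AssocScheme (s * s)) → (Fin g → Fin s → Fin (s * s) → Bool) → Set
CondB {g} {s} S B =
  ∀ (t : Fin (s * s)) →
  Σ (Fin g → Fin (s * s) → Bool) λ A →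
    (∀ k l → k ≢ l → ∀ x → A k x ≡ true → A l x ≡ false) ×
    (∀ k → card (A k) ≡ s ∸ 1) ×
    (∀ x → (first S t x ≡ true) ⇔ (∃[ k ] A k x ≡ true)) ×
    (∀ k → IsClique S (λ x → (t == x) ∨ A k x)) ×
    (Σ (Fin g → Fin g) λ κ →
       Bijective _≡_ _≡_ κ ×
       (∀ i m → B i m t ≡ true → ∀ x → B i m x ≡ ((t == x) ∨ A (κ i) x)))

module Submission where

-- Everything is double counting with Boolean indicators on Fin n.  A_i := (block of P_i through t) ∖ {t}; these are disjoint,
-- consist of first associates, and have g(s - 1) = n_1 members in total,
-- so they cover all first associates; the bijection is the identity.
-- (B) ⇒ (A): blocks have 1 + (s - 1) elements; blocks of different
-- partitions share at most one treatment (a second one would lie in two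
-- disjoint A_k), and s such intersections add up to s, so each is 1.

open import Defs
open import Data.Nat using (ℕ; zero; suc; _+_; _*_; _∸_; _≤_; z≤n; s≤s; s≤s⁻¹)
open import Data.Nat.Properties
  using (≤-refl; ≤-trans; ≤-reflexive; ≤-antisym; 1+n≰n; m≤n+m; +-mono-≤;
         +-cancelˡ-≤; +-cancelʳ-≤; +-suc; *-identityʳ; m+[n∸m]≡n; +-0-commutativeMonoid)
open import Data.Bool using (Bool; true; false; _∧_; _∨_; not; if_then_else_)
open import Data.Fin using (Fin; zero; suc; _≟_)
open import Data.Fin.Properties using (suc-injective; 0≢1+n)
open import Data.Product using (∃-syntax; _,_; proj₁; proj₂)
open import Data.Empty using (⊥-elim)
open import Relation.Nullary using (¬_; yes; no)
open import Relation.Binary.PropositionalEquality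
  using (_≡_; _≢_; refl; sym; trans; cong; cong₂; subst; module ≡-Reasoning)
open import Function.Base using (_∘_; id)
open import Function.Bundles using (_⇔_; mk⇔; Equivalence)
open import Function.Construct.Identity using (bijective)
open import Algebra.Properties.CommutativeMonoid.Sum +-0-commutativeMonoid
  using (sum-syntax; sum-cong-≗; ∑-comm)

∧-elimˡ : ∀ {a b} → a ∧ b ≡ true → a ≡ true
∧-elimˡ {true} _ = refl

∧-elimʳ : ∀ {a b} → a ∧ b ≡ true → b ≡ true
∧-elimʳ {true} p = p

true≢false : true ≢ false
true≢false ()

contraposeᵇ : ∀ {b c} → (b ≡ true → c ≡ true) → c ≡ false → b ≡ false
contraposeᵇ {false} _ _ = refl
contraposeᵇ {true} imp c≡false = ⊥-elim (true≢false (trans (sym (imp refl)) c≡false))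

==-refl : ∀ {n} (t : Fin n) → (t == t) ≡ true
==-refl t with t ≟ t
... | yes _ = refl
... | no t≢t = ⊥-elim (t≢t refl)

==-sound : ∀ {n} {t x : Fin n} → (t == x) ≡ true → t ≡ x
==-sound {t = t} {x} p with t ≟ x
... | yes t≡x = t≡x

==-false : ∀ {n} {t x : Fin n} → t ≢ x → (t == x) ≡ false
==-false {t = t} {x} t≢x with t ≟ x
... | yes t≡x = ⊥-elim (t≢x t≡x)
... | no _ = refl

insert : ∀ {n} → Fin n → (Fin n → Bool) → Fin n → Bool
insert t X x = (t == x) ∨ X x

remove : ∀ {n} → Fin n → (Fin n → Bool) → Fin n → Bool
remove t X x = X x ∧ not (t == x)

remove-⊆ : ∀ {n} {t x : Fin n} (X : Fin n → Bool) → remove t X x ≡ true → X x ≡ true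
remove-⊆ X = ∧-elimˡ

remove-≢ : ∀ {n} {t x : Fin n} (X : Fin n → Bool) → remove t X x ≡ true → t ≢ x
remove-≢ {t = t} X p refl = true≢false (trans (sym (∧-elimʳ {X t} p)) (cong not (==-refl t)))

remove-self : ∀ {n} (t : Fin n) (X : Fin n → Bool) → remove t X t ≡ false
remove-self t X = contraposeᵇ (λ p → ⊥-elim (remove-≢ X p refl)) refl

insert-remove : ∀ {n} {t : Fin n} (X : Fin n → Bool) → X t ≡ true →
  ∀ x → X x ≡ insert t (remove t X) x
insert-remove {t = t} X Xt x with t ≟ x
... | yes refl = Xt
... | no _ with X x
...   | true = refl
...   | false = refl

insert-≢ : ∀ {n} {t x : Fin n} (X : Fin n → Bool) → t ≢ x → insert t X x ≡ X x
insert-≢ X t≢x = cong (_∨ X _) (==-false t≢x)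

ind : Bool → ℕ
ind b = if b then 1 else 0

card-sum : ∀ {n} (f : Fin n → Bool) → card f ≡ ∑[ x < n ] ind (f x)
card-sum {zero} f = refl
card-sum {suc n} f = cong (ind (f zero) +_) (card-sum (f ∘ suc))

card-cong : ∀ {n} {f h : Fin n → Bool} → (∀ x → f x ≡ h x) → card f ≡ card h
card-cong {zero} e = refl
card-cong {suc n} e = cong₂ _+_ (cong ind (e zero)) (card-cong (e ∘ suc))

card-empty : ∀ {n} (f : Fin n → Bool) → (∀ x → f x ≡ false) → card f ≡ 0
card-empty {zero} f e = refl
card-empty {suc n} f e rewrite e zero = card-empty (f ∘ suc) (e ∘ suc)

card-head : ∀ {n} (f : Fin (suc n) → Bool) → f zero ≡ true → card f ≡ suc (card (f ∘ suc))
card-head f e rewrite e = refl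

card-pos : ∀ {n} (f : Fin n → Bool) {a} → f a ≡ true → 1 ≤ card f
card-pos f {zero} fa rewrite fa = s≤s z≤n
card-pos f {suc a} fa = ≤-trans (card-pos (f ∘ suc) fa) (m≤n+m _ (ind (f zero)))

card-witness : ∀ {n} (f : Fin n → Bool) → 1 ≤ card f → ∃[ a ] f a ≡ true
card-witness {suc n} f pos with f zero in e
... | true = zero , e
... | false with card-witness (f ∘ suc) pos
...   | a , fa = suc a , fa

AtMostOne : ∀ {n} → (Fin n → Bool) → Set
AtMostOne f = ∀ a b → f a ≡ true → f b ≡ true → a ≡ b

atMostOne⇒card≤1 : ∀ {n} (f : Fin n → Bool) → AtMostOne f → card f ≤ 1
atMostOne⇒card≤1 {zero} f u = z≤n
atMostOne⇒card≤1 {suc n} f u with f zero in e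
... | true = ≤-reflexive (cong suc (card-empty (f ∘ suc) tail-empty))
  where
  tail-empty : ∀ x → f (suc x) ≡ false
  tail-empty x = contraposeᵇ (λ fx → ⊥-elim (0≢1+n (u zero (suc x) e fx))) refl
... | false = atMostOne⇒card≤1 (f ∘ suc) (λ a b fa fb → suc-injective (u (suc a) (suc b) fa fb))

card≤1⇒atMostOne : ∀ {n} (f : Fin n → Bool) → card f ≤ 1 → AtMostOne f
card≤1⇒atMostOne f le zero zero fa fb = refl
card≤1⇒atMostOne f le zero (suc b) fa fb = ⊥-elim (head-and-tail fa fb le)
  where
  head-and-tail : f zero ≡ true → f (suc b) ≡ true → ¬ (card f ≤ 1)
  head-and-tail fz fs le =
    1+n≰n (≤-trans (card-pos (f ∘ suc) fs) (s≤s⁻¹ (subst (_≤ 1) (card-head f fz) le)))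
card≤1⇒atMostOne f le (suc a) zero fa fb = sym (card≤1⇒atMostOne f le zero (suc a) fb fa)
card≤1⇒atMostOne f le (suc a) (suc b) fa fb =
  cong suc (card≤1⇒atMostOne (f ∘ suc) (≤-trans (m≤n+m _ (ind (f zero))) le) a b fa fb)

card-exactly-one : ∀ {n} (f : Fin n → Bool) → ∃[ a ] f a ≡ true → AtMostOne f → card f ≡ 1
card-exactly-one f (a , fa) u = ≤-antisym (atMostOne⇒card≤1 f u) (card-pos f fa)

card-singleton : ∀ {n} (t : Fin n) → card (t ==_) ≡ 1
card-singleton t = card-exactly-one (t ==_) (t , ==-refl t)
  (λ a b p q → trans (sym (==-sound p)) (==-sound q))

card-∨ : ∀ {n} (f h : Fin n → Bool) → (∀ x → f x ∧ h x ≡ false) →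
  card (λ x → f x ∨ h x) ≡ card f + card h
card-∨ {zero} f h disj = refl
card-∨ {suc n} f h disj with f zero | h zero | disj zero | card-∨ (f ∘ suc) (h ∘ suc) (disj ∘ suc)
... | true  | true  | () | _
... | true  | false | _  | ih = cong suc ih
... | false | true  | _  | ih = trans (cong suc ih) (sym (+-suc _ _))
... | false | false | _  | ih = ih

card-insert : ∀ {n} {t : Fin n} (X : Fin n → Bool) → X t ≡ false →
  card (insert t X) ≡ suc (card X)
card-insert {t = t} X Xt = trans (card-∨ (t ==_) X disjoint) (cong (_+ card X) (card-singleton t))
  where
  disjoint : ∀ x → (t == x) ∧ X x ≡ false
  disjoint x with t ≟ x
  ... | yes refl = Xt
  ... | no _ = refl

sum-const : ∀ k c → ∑[ a < k ] c ≡ k * c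
sum-const zero c = refl
sum-const (suc k) c = cong (c +_) (sum-const k c)

sum-mono : ∀ {k} (h h' : Fin k → ℕ) → (∀ a → h a ≤ h' a) → ∑[ a < k ] h a ≤ ∑[ a < k ] h' a
sum-mono {zero} h h' le = z≤n
sum-mono {suc k} h h' le = +-mono-≤ (le zero) (sum-mono (h ∘ suc) (h' ∘ suc) (le ∘ suc))

sum-tight : ∀ {k} (h h' : Fin k → ℕ) → (∀ a → h a ≤ h' a) →
  ∑[ a < k ] h' a ≤ ∑[ a < k ] h a → ∀ a → h a ≡ h' a
sum-tight {suc k} h h' le total = pointwise
  where
  rest rest' : ℕ
  rest = ∑[ a < k ] h (suc a)
  rest' = ∑[ a < k ] h' (suc a)
  rest≤rest' : rest ≤ rest'
  rest≤rest' = sum-mono (h ∘ suc) (h' ∘ suc) (le ∘ suc)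
  head-tight : h' zero ≤ h zero
  head-tight = +-cancelʳ-≤ rest' (h' zero) (h zero)
    (≤-trans total (+-mono-≤ (≤-refl {h zero}) rest≤rest'))
  rest-tight : rest' ≤ rest
  rest-tight = +-cancelˡ-≤ (h' zero) rest' rest
    (≤-trans total (+-mono-≤ (le zero) (≤-refl {rest})))
  pointwise : ∀ a → h a ≡ h' a
  pointwise zero = ≤-antisym (le zero) head-tight
  pointwise (suc a) = sum-tight (h ∘ suc) (h' ∘ suc) (le ∘ suc) rest-tight a

incidences : ∀ {k n} (P : Fin k → Fin n → Bool) →
  ∑[ a < k ] card (P a) ≡ ∑[ x < n ] card (λ a → P a x)
incidences {k} {n} P = begin
  ∑[ a < k ] card (P a)                ≡⟨ sum-cong-≗ (card-sum ∘ P) ⟩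
  ∑[ a < k ] ∑[ x < n ] ind (P a x)    ≡⟨ ∑-comm (λ a x → ind (P a x)) ⟩
  ∑[ x < n ] ∑[ a < k ] ind (P a x)    ≡⟨ sum-cong-≗ (λ x → sym (card-sum (λ a → P a x))) ⟩
  ∑[ x < n ] card (λ a → P a x)        ∎
  where open ≡-Reasoning

card-first : ∀ {v} (S : AssocScheme v) (t : Fin v) → card (first S t) ≡ n S c1
card-first S t = trans (card-cong first-is-class-1) (valency S c1 t)
  where
  first-is-class-1 : ∀ x → first S t x ≡ assocᵇ (first S) c1 t x
  first-is-class-1 x with t ≟ x
  ... | yes refl = first-irr S t
  ... | no _ = refl

module CliquePartition {v s} (S : AssocScheme v) (P : Fin s → Fin v → Bool)
                       (isP : IsCliquePartition S P) where

  clique : ∀ m → IsClique S (P m)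
  clique = proj₁ isP

  nonempty : ∀ m → ∃[ t ] P m t ≡ true
  nonempty = proj₁ (proj₂ isP)

  disjoint : ∀ m m' t → P m t ≡ true → P m' t ≡ true → m ≡ m'
  disjoint = proj₂ (proj₂ (proj₂ isP))

  blockOf : Fin v → Fin s
  blockOf t = proj₁ (proj₁ (proj₂ (proj₂ isP)) t)

  ∈-blockOf : ∀ t → P (blockOf t) t ≡ true
  ∈-blockOf t = proj₂ (proj₁ (proj₂ (proj₂ isP)) t)

  partition-count : ∀ (X : Fin v → Bool) → ∑[ m < s ] card (λ x → X x ∧ P m x) ≡ card X
  partition-count X = begin
    ∑[ m < s ] card (λ x → X x ∧ P m x)    ≡⟨ incidences (λ m x → X x ∧ P m x) ⟩
    ∑[ x < v ] card (λ m → X x ∧ P m x)    ≡⟨ sum-cong-≗ one-block-each ⟩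
    ∑[ x < v ] ind (X x)                   ≡⟨ sym (card-sum X) ⟩
    card X                                 ∎
    where
    open ≡-Reasoning
    one-block-each : ∀ x → card (λ m → X x ∧ P m x) ≡ ind (X x)
    one-block-each x with X x
    ... | false = card-empty {s} _ (λ _ → refl)
    ... | true = card-exactly-one _ (blockOf x , ∈-blockOf x) (λ m m' → disjoint m m' x)

another-index : ∀ {g} → 2 ≤ g → (i : Fin g) → ∃[ j ] j ≢ i
another-index (s≤s (s≤s _)) zero = suc zero , λ ()
another-index (s≤s (s≤s _)) (suc i) = zero , λ ()

module FromA {g s} (S : AssocScheme (s * s)) (B : Fin g → Fin s → Fin (s * s) → Bool)
             (parts : ∀ i → IsCliquePartition S (B i))
             (another : ∀ (i : Fin g) → ∃[ j ] j ≢ i)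
             (n₁ : n S c1 ≡ g * (s ∸ 1))
             (condA : CondA B) where

  module P (i : Fin g) = CliquePartition S (B i) (parts i)

  -- Counting B^i_m against the partition P_j, j ≠ i: s blocks, one common
  -- treatment with each.
  block-size : ∀ i m → card (B i m) ≡ s
  block-size i m with another i
  ... | j , j≢i = begin
    card (B i m)                                ≡⟨ sym (P.partition-count j (B i m)) ⟩
    ∑[ m' < s ] card (λ x → B i m x ∧ B j m' x) ≡⟨ sum-cong-≗ (condA i j (j≢i ∘ sym) m) ⟩
    ∑[ m' < s ] 1                               ≡⟨ sum-const s 1 ⟩
    s * 1                                       ≡⟨ *-identityʳ s ⟩
    s                                           ∎
    where open ≡-Reasoning

  module AtTreatment (t : Fin (s * s)) where

    Bt : Fin g → Fin (s * s) → Bool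
    Bt i = B i (P.blockOf i t)

    A : Fin g → Fin (s * s) → Bool
    A i = remove t (Bt i)

    Bt≡insertA : ∀ i x → Bt i x ≡ insert t (A i) x
    Bt≡insertA i = insert-remove (Bt i) (P.∈-blockOf i t)

    A-size : ∀ i → card (A i) ≡ s ∸ 1
    A-size i = cong (_∸ 1) (begin
      suc (card (A i))        ≡⟨ sym (card-insert (A i) (remove-self t (Bt i))) ⟩
      card (insert t (A i))   ≡⟨ sym (card-cong (Bt≡insertA i)) ⟩
      card (Bt i)             ≡⟨ block-size i (P.blockOf i t) ⟩
      s                       ∎)
      where open ≡-Reasoning

    -- The blocks through t of two different partitions meet only in t.
    A-disjoint : ∀ k l → k ≢ l → ∀ x → A k x ≡ true → A l x ≡ false
    A-disjoint k l k≢l x Akx = contraposeᵇ (λ Alx → ⊥-elim (remove-≢ (Bt k) Akx (only-t Alx))) refl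
      where
      common : Fin (s * s) → Bool
      common y = Bt k y ∧ Bt l y
      only-t : A l x ≡ true → t ≡ x
      only-t Alx = card≤1⇒atMostOne common (≤-reflexive (condA k l k≢l _ _)) t x
        (cong₂ _∧_ (P.∈-blockOf k t) (P.∈-blockOf l t))
        (cong₂ _∧_ (remove-⊆ (Bt k) Akx) (remove-⊆ (Bt l) Alx))

    A-clique : ∀ k → IsClique S (insert t (A k))
    A-clique k x y px py = P.clique k (P.blockOf k t) x y
      (trans (Bt≡insertA k x) px) (trans (Bt≡insertA k y) py)

    A⊆first : ∀ k x → A k x ≡ true → first S t x ≡ true
    A⊆first k x Akx = P.clique k (P.blockOf k t) t x
      (P.∈-blockOf k t) (remove-⊆ (Bt k) Akx) (remove-≢ (Bt k) Akx)

    memberships : ∀ x → card (λ k → A k x) ≤ ind (first S t x)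
    memberships x with first S t x in e
    ... | true = atMostOne⇒card≤1 _ at-most-one
      where
      at-most-one : AtMostOne (λ k → A k x)
      at-most-one k l Akx Alx with k ≟ l
      ... | yes k≡l = k≡l
      ... | no k≢l = ⊥-elim (true≢false (trans (sym Alx) (A-disjoint k l k≢l x Akx)))
    ... | false = ≤-reflexive (card-empty _ (λ k → contraposeᵇ (A⊆first k x) e))

    -- The A_k have g(s - 1) = n_1 members in total, as many as t has first
    -- associates, so every first associate is a member.
    A-covers : ∀ x → first S t x ≡ true → ∃[ k ] A k x ≡ true
    A-covers x tx = card-witness _ (≤-reflexive (sym
      (trans (sum-tight _ _ memberships total x) (cong ind tx))))
      where
      open ≡-Reasoning
      total : ∑[ y < s * s ] ind (first S t y) ≤ ∑[ y < s * s ] card (λ k → A k y)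
      total = ≤-reflexive (begin
        ∑[ y < s * s ] ind (first S t y)     ≡⟨ sym (card-sum (first S t)) ⟩
        card (first S t)                     ≡⟨ trans (card-first S t) n₁ ⟩
        g * (s ∸ 1)                          ≡⟨ sym (sum-const g (s ∸ 1)) ⟩
        ∑[ k < g ] (s ∸ 1)                   ≡⟨ sym (sum-cong-≗ A-size) ⟩
        ∑[ k < g ] card (A k)                ≡⟨ incidences A ⟩
        ∑[ y < s * s ] card (λ k → A k y)    ∎)

    first⇔A : ∀ x → (first S t x ≡ true) ⇔ (∃[ k ] A k x ≡ true)
    first⇔A x = mk⇔ (A-covers x) (λ (k , Akx) → A⊆first k x Akx)

    blocks : ∀ i m → B i m t ≡ true → ∀ x → B i m x ≡ insert t (A i) x
    blocks i m Bimt x with P.disjoint i m (P.blockOf i t) t Bimt (P.∈-blockOf i t)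
    ... | refl = Bt≡insertA i x

  condB : CondB S B
  condB t = A , A-disjoint , A-size , first⇔A , A-clique , id , bijective _≡_ , blocks
    where open AtTreatment t

module FromB {g s} (S : AssocScheme (s * s)) (B : Fin g → Fin s → Fin (s * s) → Bool)
             (parts : ∀ i → IsCliquePartition S (B i))
             (s≥1 : 1 ≤ s)
             (condB : CondB S B) where

  module P (i : Fin g) = CliquePartition S (B i) (parts i)

  -- A block through t is {t} ∪ A_k, with t ∉ A_k since t is not its own
  -- first associate.
  block-size : ∀ i m → card (B i m) ≡ s
  block-size i m with P.nonempty i m
  ... | t , Bimt with condB t
  ...   | A , _ , A-size , first⇔A , _ , κ , _ , blocks = begin
    card (B i m)                ≡⟨ card-cong (blocks i m Bimt) ⟩
    card (insert t (A (κ i)))   ≡⟨ card-insert (A (κ i)) t∉A ⟩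
    suc (card (A (κ i)))        ≡⟨ cong suc (A-size (κ i)) ⟩
    suc (s ∸ 1)                 ≡⟨ m+[n∸m]≡n s≥1 ⟩
    s                           ∎
    where
    open ≡-Reasoning
    t∉A : A (κ i) t ≡ false
    t∉A = contraposeᵇ (λ At → Equivalence.from (first⇔A t) (κ i , At)) (first-irr S t)

  -- Two treatments x ≠ y in B^i_m ∩ B^j_n would put y into A_{k_i} and
  -- A_{k_j} at x, which are disjoint because i ↦ k_i is injective.
  common-atMostOne : ∀ i j → i ≢ j → ∀ m n → AtMostOne (λ x → B i m x ∧ B j n x)
  common-atMostOne i j i≢j m n x y x∈ y∈ with x ≟ y
  ... | yes x≡y = x≡y
  ... | no x≢y with condB x
  ...   | A , A-disjoint , _ , _ , _ , κ , (κ-injective , _) , blocks =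
    ⊥-elim (true≢false (trans (sym (y∈A j n (∧-elimʳ x∈) (∧-elimʳ y∈)))
      (A-disjoint (κ i) (κ j) (i≢j ∘ κ-injective) y (y∈A i m (∧-elimˡ x∈) (∧-elimˡ y∈)))))
    where
    y∈A : ∀ i' m' → B i' m' x ≡ true → B i' m' y ≡ true → A (κ i') y ≡ true
    y∈A i' m' x∈B y∈B =
      trans (sym (insert-≢ (A (κ i')) x≢y)) (trans (sym (blocks i' m' x∈B y)) y∈B)

  -- The s intersections of B^i_m with the blocks of P_j have at most one
  -- element each and add up to |B^i_m| = s, so each has exactly one.
  condA : CondA B
  condA i j i≢j m = sum-tight intersection (λ _ → 1)
    (λ n → atMostOne⇒card≤1 _ (common-atMostOne i j i≢j m n)) (≤-reflexive total)
    where
    intersection : Fin s → ℕ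
    intersection n = card (λ x → B i m x ∧ B j n x)
    total : ∑[ n < s ] 1 ≡ ∑[ n < s ] intersection n
    total = begin
      ∑[ n < s ] 1                  ≡⟨ sum-const s 1 ⟩
      s * 1                         ≡⟨ *-identityʳ s ⟩
      s                             ≡⟨ sym (block-size i m) ⟩
      card (B i m)                  ≡⟨ sym (P.partition-count j (B i m)) ⟩
      ∑[ n < s ] intersection n     ∎
      where open ≡-Reasoning

-- The main theorem: g ≥ 3 gives a second partition index, g ≤ s gives s ≥ 1.
theorem3p6 : (g s : ℕ) → 3 ≤ g → g ≤ s →
    (S : AssocScheme (s * s)) → IsPseudoL g s S →
    (B : Fin g → Fin s → Fin (s * s) → Bool) →
    (∀ i → IsCliquePartition S (B i)) →
    CondA B ⇔ CondB S B
theorem3p6 g s g≥3 g≤s S (n₁ , _) B parts =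
  mk⇔ (FromA.condB S B parts (another-index g≥2) n₁) (FromB.condA S B parts s≥1)
  where
  g≥2 : 2 ≤ g
  g≥2 = ≤-trans (s≤s (s≤s z≤n)) g≥3
  s≥1 : 1 ≤ s
  s≥1 = ≤-trans (≤-trans (s≤s z≤n) g≥2) g≤s
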